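{- Let $j\geq m\geq 2$ and $n\geq 2$ be integers, and let $G$ be a graph with maximum degree $\Delta=\Delta(G)$. Then \[ m_j(K_m,G)\geq \Big\lfloor \frac{\Delta-1}{\lceil \frac{j}{m-1}\rceil-1}\Big\rfloor+1 . \]
   Context: All graphs are simple; $K_m$ is the complete graph on $m$ vertices. For integers $j\geq 2$ and $t\geq 1$, $K_{j\times t}$ denotes the complete multipartite graph with $j$ parts, each of size $t$. For graphs $H$ and $G$, the size multipartite Ramsey number $m_j(H,G)$ is the smallest natural number $t$ such that every coloring of the edges of $K_{j\times t}$ with two colors red and blue contains a red copy of $H$ or a blue copy of $G$ as a subgraph. -}

module Defs where

open import Data.Nat using (ℕ; zero; suc; _+_; _∸_; _⊔_; _/_; _<_)
open import Data.Sum using (_⊎_)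
open import Data.Bool using (Bool; true; false)
open import Data.Fin using (Fin)
open import Data.List using (List; length; filter; map; foldr; allFin)
open import Data.Product using (_×_; _,_; proj₁; proj₂; Σ)
open import Relation.Binary.PropositionalEquality using (_≡_; _≢_)
open import Relation.Nullary using (¬_)
open import Data.Bool.Properties using (T?)
open import Function.Definitions using (Injective)

record Graph (n : ℕ) : Set where
  field
    adj    : Fin n → Fin n → Bool
    adjSym    : ∀ u v → adj u v ≡ adj v u
    adjIrrefl : ∀ v → adj v v ≡ false
open Graph public

degree : ∀ {n} → Graph n → Fin n → ℕ
degree {n} G v = length (filter (λ w → T? (adj G v w)) (allFin n))

maxDegree : ∀ {n} → Graph n → ℕ
maxDegree {n} G = foldr _⊔_ 0 (map (degree G) (allFin n))

completeGraph : (m : ℕ) → Graph m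
completeGraph m = record { adj = λ u v → not≡ u v ; adjSym = symK ; adjIrrefl = irrK }
  where
    open import Data.Fin using (_≟_)
    open import Relation.Nullary.Decidable using (⌊_⌋)
    open import Data.Bool using (not)
    open import Relation.Nullary using (yes; no)
    open import Relation.Binary.PropositionalEquality using (refl; sym)
    not≡ : Fin m → Fin m → Bool
    not≡ u v = not ⌊ u ≟ v ⌋
    symK : ∀ u v → not≡ u v ≡ not≡ v u
    symK u v with u ≟ v | v ≟ u
    ... | yes _ | yes _ = refl
    ... | no _  | no _  = refl
    ... | yes p | no q  with q (sym p)
    ... | ()
    symK u v | no q | yes p with q (sym p)
    ... | ()
    irrK : ∀ v → not≡ v v ≡ false
    irrK v with v ≟ v
    ... | yes _ = refl
    ... | no q with q refl
    ... | ()

-- Complete multipartite graph K_{j×t}: vertices are pairs (part, index),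
-- two vertices adjacent iff they lie in different parts.
MVertex : ℕ → ℕ → Set
MVertex j t = Fin j × Fin t

MAdj : ∀ {j t} → MVertex j t → MVertex j t → Set
MAdj u v = proj₁ u ≢ proj₁ v

data Colour : Set where
  red blue : Colour

-- A 2-colouring of the edges of K_{j×t}: a symmetric colour assignment to
-- pairs of vertices (values on non-edges are irrelevant).
record Colouring (j t : ℕ) : Set where
  field
    col    : MVertex j t → MVertex j t → Colour
    colSym : ∀ u v → col u v ≡ col v u
open Colouring public

MonoCopy : ∀ {j t k} → Colouring j t → Colour → Graph k → Set
MonoCopy {j} {t} {k} χ c H =
  Σ (Fin k → MVertex j t) λ f →
    Injective _≡_ _≡_ f ×
    (∀ a b → adj H a b ≡ true → MAdj (f a) (f b) × col χ (f a) (f b) ≡ c)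

RamseyProp : ∀ {k n} → ℕ → Graph k → Graph n → ℕ → Set
RamseyProp j H G t =
  ∀ (χ : Colouring j t) → MonoCopy χ red H ⊎ MonoCopy χ blue G

IsSizeMultipartiteRamsey : ∀ {k n} → ℕ → Graph k → Graph n → ℕ → Set
IsSizeMultipartiteRamsey j H G t =
  RamseyProp j H G t × (∀ t′ → t′ < t → ¬ RamseyProp j H G t′)

-- ⌈ a / d ⌉ and ⌊ a / d ⌋ (only used with d ≥ 1; value 0 for d = 0 is a dummy)
ceilDiv : ℕ → ℕ → ℕ
ceilDiv a zero    = 0
ceilDiv a (suc d) = (a + d) / suc d

floorDiv : ℕ → ℕ → ℕ
floorDiv a zero    = 0
floorDiv a (suc d) = a / suc d

-- ⌊ (Δ-1) / (⌈ j/(m-1) ⌉ - 1) ⌋ + 1, computed over the integers.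
-- For Δ = 0 the floor is ⌊ -1 / k ⌋ = -1 (k ≥ 1), so the bound is 0.
lowerBound : ℕ → ℕ → ℕ → ℕ
lowerBound j m zero    = 0
lowerBound j m (suc δ) = floorDiv δ (ceilDiv j (m ∸ 1) ∸ 1) + 1

{-# OPTIONS --safe #-}
-- Write d = m − 1 and K = ⌈j/d⌉, and place part p of K_{j×t} in row ⌊p/d⌋ and
-- column (class) p mod d of a K × d grid. Colour an edge blue when its ends lie
-- in parts of the same class and red otherwise. A red K_m would put m vertices
-- into d classes, so two of them share a class. In a blue copy of G every
-- neighbour of a vertex lies in one of the other K − 1 parts of its class,
-- so Δ ≤ (K − 1) t, which rearranges to the stated bound.
module Submission where

open import Defs
open import Data.Nat using (ℕ; zero; suc; _+_; _*_; _∸_; _≤_; _<_; z≤n; s≤s)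
open import Data.Nat.Properties
  using (⊔-lub; n<1+n; ≤-pred; +-comm; *-comm; +-cancelʳ-≤; +-monoˡ-≤; module ≤-Reasoning)
open import Data.Nat.DivMod using (_%_; m≡m%n+[m/n]*n; m%n<n; m<n*o⇒m/o<n)
open import Data.Fin as Fin using (Fin; _≟_; punchOut; combine; remQuot; inject≤)
open import Data.Fin.Properties
  using (pigeonhole; <⇒≢; punchOut-injective; combine-injective; combine-remQuot; inject≤-injective; injective⇒≤)
open import Data.List using (List; _∷_; lookup; filter; allFin)
open import Data.List.Properties using (foldr-preservesᵇ)
open import Data.List.Membership.Propositional using (_∈_)
open import Data.List.Membership.Propositional.Properties using (∈-lookup; ∈-filter⁻)
import Data.List.Relation.Unary.All as All
open import Data.List.Relation.Unary.All.Properties using (map⁺; tabulate⁺)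
open import Data.List.Relation.Unary.AllPairs using (_∷_)
open import Data.List.Relation.Unary.Unique.Propositional using (Unique)
open import Data.List.Relation.Unary.Unique.Propositional.Properties using (filter⁺; allFin⁺)
open import Data.Product using (_×_; _,_; proj₁; proj₂; uncurry)
open import Data.Sum using (inj₁; inj₂)
open import Data.Bool using (true)
open import Data.Bool.Properties using (T?; T-≡)
open import Data.Empty using (⊥-elim)
open import Function using (_∘_; Equivalence)
open import Function.Definitions using (Injective)
open import Relation.Nullary using (¬_; yes; no; contradiction)
open import Relation.Binary.PropositionalEquality
  using (_≡_; _≢_; refl; sym; trans; cong; cong₂; subst; module ≡-Reasoning)

lookup-injective : ∀ {A : Set} {xs : List A} → Unique xs → Injective _≡_ _≡_ (lookup xs)
lookup-injective (x∉xs ∷ xs!) {Fin.zero}  {Fin.zero}  _  = refl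
lookup-injective (x∉xs ∷ xs!) {Fin.zero}  {Fin.suc k} eq =
  contradiction eq (All.lookup x∉xs (∈-lookup k))
lookup-injective (x∉xs ∷ xs!) {Fin.suc i} {Fin.zero}  eq =
  contradiction (sym eq) (All.lookup x∉xs (∈-lookup i))
lookup-injective (x∉xs ∷ xs!) {Fin.suc i} {Fin.suc k} eq =
  cong Fin.suc (lookup-injective xs! eq)

neighbours : ∀ {n} → Graph n → Fin n → List (Fin n)
neighbours {n} G v = filter (λ w → T? (adj G v w)) (allFin n)

∈-neighbours⁻ : ∀ {n} (G : Graph n) {v w} → w ∈ neighbours G v → adj G v w ≡ true
∈-neighbours⁻ {n} G {v} w∈ =
  Equivalence.to T-≡ (proj₂ (∈-filter⁻ (λ w → T? (adj G v w)) {xs = allFin n} w∈))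

degree-≤ : ∀ {n M} (G : Graph n) v (code : ∀ w → adj G v w ≡ true → Fin M) →
           (∀ {w w′} vw vw′ → code w vw ≡ code w′ vw′ → w ≡ w′) → degree G v ≤ M
degree-≤ {n} G v code code-injective =
  injective⇒≤ {f = λ i → code (nbr i) (∈-neighbours⁻ G (∈-lookup i))}
    (lookup-injective (filter⁺ (λ w → T? (adj G v w)) (allFin⁺ n)) ∘ code-injective _ _)
  where
  nbr = lookup (neighbours G v)

maxDegree-lub : ∀ {n b} (G : Graph n) → (∀ v → degree G v ≤ b) → maxDegree G ≤ b
maxDegree-lub {b = b} G degree≤b =
  foldr-preservesᵇ {P = _≤ b} ⊔-lub z≤n (map⁺ (tabulate⁺ degree≤b))

completeGraph-adj : ∀ {m} {a b : Fin m} → a ≢ b → adj (completeGraph m) a b ≡ true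
completeGraph-adj {a = a} {b} a≢b with a ≟ b
... | yes a≡b = contradiction a≡b a≢b
... | no _    = refl

classColour : ∀ {d} → Fin d → Fin d → Colour
classColour a b with a ≟ b
... | yes _ = blue
... | no _  = red

classColour-sym : ∀ {d} (a b : Fin d) → classColour a b ≡ classColour b a
classColour-sym a b with a ≟ b | b ≟ a
... | yes _   | yes _   = refl
... | no _    | no _    = refl
... | yes a≡b | no b≢a  = contradiction (sym a≡b) b≢a
... | no a≢b  | yes b≡a = contradiction (sym b≡a) a≢b

classColour-blue⇒≡ : ∀ {d} {a b : Fin d} → classColour a b ≡ blue → a ≡ b
classColour-blue⇒≡ {a = a} {b} eq with a ≟ b
... | yes a≡b = a≡b

classColour-red⇒≢ : ∀ {d} {a b : Fin d} → classColour a b ≡ red → a ≢ b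
classColour-red⇒≢ {a = a} {b} eq with a ≟ b
... | no a≢b = a≢b

classColouring : ∀ {j d} → (Fin j → Fin d) → ∀ t → Colouring j t
classColouring cls t = record
  { col    = λ u w → classColour (cls (proj₁ u)) (cls (proj₁ w))
  ; colSym = λ u w → classColour-sym (cls (proj₁ u)) (cls (proj₁ w))
  }

classColouring-noRedClique : ∀ {j d t} (cls : Fin j → Fin d) →
                             ¬ MonoCopy (classColouring cls t) red (completeGraph (suc d))
classColouring-noRedClique {d = d} cls (f , _ , red-edges)
  with a , b , a<b , sameClass ← pigeonhole (n<1+n d) (cls ∘ proj₁ ∘ f) =
  classColour-red⇒≢ (proj₂ (red-edges a b (completeGraph-adj (<⇒≢ a<b)))) sameClass

classColouring-blueDegree : ∀ {j K d t n} (place : Fin j → Fin K × Fin d) → Injective _≡_ _≡_ place →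
                            (G : Graph n) → MonoCopy (classColouring (proj₂ ∘ place) t) blue G →
                            ∀ v → degree G v ≤ (K ∸ 1) * t
classColouring-blueDegree {K = zero} place _ G (f , _) v with place (proj₁ (f v))
... | () , _
classColouring-blueDegree {K = suc K} {t = t} place place-injective G (f , f-injective , blue-edges) v =
  degree-≤ G v code code-injective
  where
  row = proj₁ ∘ place
  class = proj₂ ∘ place
  part = proj₁ ∘ f

  sameClass : ∀ {w} → adj G v w ≡ true → class (part v) ≡ class (part w)
  sameClass vw = classColour-blue⇒≡ (proj₂ (blue-edges v _ vw))

  otherRow : ∀ {w} → adj G v w ≡ true → row (part v) ≢ row (part w)
  otherRow vw sameRow = proj₁ (blue-edges v _ vw) (place-injective (cong₂ _,_ sameRow (sameClass vw)))

  code : ∀ w → adj G v w ≡ true → Fin (K * t)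
  code w vw = combine (punchOut (otherRow vw)) (proj₂ (f w))

  code-injective : ∀ {w w′} vw vw′ → code w vw ≡ code w′ vw′ → w ≡ w′
  code-injective vw vw′ eq with rows , indices ← combine-injective _ _ _ _ eq =
    f-injective (cong₂ _,_ (place-injective samePlace) indices)
    where
    samePlace = cong₂ _,_ (punchOut-injective (otherRow vw) (otherRow vw′) rows)
                          (trans (sym (sameClass vw)) (sameClass vw′))

m≤ceilDiv*n : ∀ m n → m ≤ ceilDiv m (suc n) * suc n
m≤ceilDiv*n m n = +-cancelʳ-≤ n m (q * suc n) (begin
  m + n                       ≡⟨ m≡m%n+[m/n]*n (m + n) (suc n) ⟩
  (m + n) % suc n + q * suc n ≤⟨ +-monoˡ-≤ (q * suc n) (≤-pred (m%n<n (m + n) (suc n))) ⟩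
  n + q * suc n               ≡⟨ +-comm n (q * suc n) ⟩
  q * suc n + n               ∎)
  where
  open ≤-Reasoning
  q = ceilDiv m (suc n)

remQuot-injective : ∀ {m} n → Injective _≡_ _≡_ (remQuot {m} n)
remQuot-injective {m} n {i} {k} eq = begin
  i                                 ≡⟨ combine-remQuot {m} n i ⟨
  uncurry combine (remQuot {m} n i) ≡⟨ cong (uncurry combine) eq ⟩
  uncurry combine (remQuot {m} n k) ≡⟨ combine-remQuot {m} n k ⟩
  k                                 ∎
  where open ≡-Reasoning

gridPlacement : ∀ j d → Fin j → Fin (ceilDiv j (suc d)) × Fin (suc d)
gridPlacement j d p = remQuot (suc d) (inject≤ p (m≤ceilDiv*n j d))

gridPlacement-injective : ∀ j d → Injective _≡_ _≡_ (gridPlacement j d)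
gridPlacement-injective j d = inject≤-injective _ _ _ _ ∘ remQuot-injective (suc d)

ramsey⇒maxDegree≤ : ∀ {j e n t} (G : Graph n) → RamseyProp j (completeGraph (2 + e)) G t →
                    maxDegree G ≤ (ceilDiv j (suc e) ∸ 1) * t
ramsey⇒maxDegree≤ {j} {e} {t = t} G ramsey with ramsey (classColouring (proj₂ ∘ gridPlacement j e) t)
... | inj₁ redClique = ⊥-elim (classColouring-noRedClique (proj₂ ∘ gridPlacement j e) redClique)
... | inj₂ blueCopy  = maxDegree-lub G
  (classColouring-blueDegree (gridPlacement j e) (gridPlacement-injective j e) G blueCopy)

floorDiv-< : ∀ {a c t} → a < c * t → floorDiv a c < t
floorDiv-< {c = zero}       ()
floorDiv-< {a} {suc c} {t} a<ct = m<n*o⇒m/o<n (subst (a <_) (*-comm (suc c) t) a<ct)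

lowerBound-≤ : ∀ {j m Δ t} → Δ ≤ (ceilDiv j (m ∸ 1) ∸ 1) * t → lowerBound j m Δ ≤ t
lowerBound-≤ {Δ = zero}  _   = z≤n
lowerBound-≤ {j} {m} {suc δ} {t} Δ≤ =
  subst (_≤ t) (+-comm 1 (floorDiv δ c)) (floorDiv-< {c = c} Δ≤)
  where c = ceilDiv j (m ∸ 1) ∸ 1

theorem3 : ∀ (j m n : ℕ) → m ≤ j → 2 ≤ m → 2 ≤ n → (G : Graph n) →
           ∀ (t : ℕ) → IsSizeMultipartiteRamsey j (completeGraph m) G t →
           lowerBound j m (maxDegree G) ≤ t
theorem3 j (suc (suc e)) n _ _ _ G t (ramsey , _) = lowerBound-≤ {j} (ramsey⇒maxDegree≤ G ramsey)
theorem3 _ 1 _ _ (s≤s ()) _ _ _ _
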